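{- The varieties $\mathcal{SL}$, $\mathcal A_{12}$, $\mathcal A_{23}$, $\mathcal F_{25}$ and $\mathcal S$ are nontrivial and pairwise distinct, and they satisfy: (a) $\mathcal{SL}\subsetneq \mathcal A_{23}\subsetneq \mathcal F_{25}$; (b) $\mathcal{SL}\subsetneq\mathcal A_{12}$; (c) $\mathcal{BA}\subsetneq\mathcal A_{12}\subsetneq\mathcal F_{25}$; (d) $\mathcal F_{25}\subsetneq \mathcal S$; (e) $\mathcal{SL}=\mathcal A_{23}\cap\mathcal A_{12}$.
   Context: A zroupoid is an algebra $\langle A,\to,0\rangle$ with $\to$ binary and $0$ a constant; write $x' := x\to 0$. An implication zroupoid ($\mathcal I$-zroupoid) is a zroupoid satisfying (I) $(x\to y)\to z \approx ((z'\to x)\to(y\to z)')'$ and (I$_0$) $0''\approx 0$. Let $\mathcal S$ be the variety of $\mathcal I$-zroupoids satisfying $x''\approx x$ and $(x\to y')'\approx (y\to x')'$. $\mathcal{SL}$ is the variety of $\mathcal I$-zroupoids satisfying $x'\approx x$ and $x\to y\approx y\to x$. $\mathcal{BA}$ is the variety of $\mathcal I$-zroupoids satisfying $(x\to y)\to x\approx x$ and $x\to x\approx 0'$ (term-equivalent to Boolean algebras; it is generated by the two-element algebra on $\{0,1\}$ with $0\to0=0\to1=1\to1=1$, $1\to0=0$). Bol-Moufang identities used: $(A_{12})$: $x\to(x\to(y\to z))\approx x\to((x\to y)\to z)$; $(A_{23})$: $x\to((x\to y)\to z)\approx (x\to x)\to(y\to z)$; $(F_{25})$: $x\to((y\to z)\to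 z)\approx ((x\to y)\to z)\to z$. For $X_{ij}$ among these, $\mathcal X_{ij}$ denotes the subvariety of $\mathcal S$ defined by $(X_{ij})$. -}

module Defs where

open import Level using (Level; _⊔_; suc)
open import Data.Product using (Σ; _×_; _,_)
open import Relation.Binary.PropositionalEquality using (_≡_; _≢_)
open import Relation.Nullary using (¬_)

record Zroupoid : Set₁ where
  infixr 5 _⇒_
  infix 8 _′
  field
    Carrier : Set
    _⇒_     : Carrier → Carrier → Carrier
    𝟎       : Carrier
  _′ : Carrier → Carrier
  x ′ = x ⇒ 𝟎

Class : Set₁
Class = Zroupoid → Set

_⊆ᶜ_ : Class → Class → Set₁
V ⊆ᶜ W = (A : Zroupoid) → V A → W A

_≐_ : Class → Class → Set₁
V ≐ W = (V ⊆ᶜ W) × (W ⊆ᶜ V)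

_⊊_ : Class → Class → Set₁
V ⊊ W = (V ⊆ᶜ W) × ¬ (W ⊆ᶜ V)

_∩ᶜ_ : Class → Class → Class
(V ∩ᶜ W) A = V A × W A

Nontrivial : Class → Set₁
Nontrivial V = Σ Zroupoid (λ A → V A × Σ (Zroupoid.Carrier A) (λ x → Σ (Zroupoid.Carrier A) (λ y → x ≢ y)))

IZ : Class
IZ A = (∀ x y z → (x ⇒ y) ⇒ z ≡ ((z ′ ⇒ x) ⇒ (y ⇒ z) ′) ′) × (𝟎 ′ ′ ≡ 𝟎)
  where open Zroupoid A

𝒮 : Class
𝒮 A = IZ A × (∀ x → x ′ ′ ≡ x) × (∀ x y → (x ⇒ y ′) ′ ≡ (y ⇒ x ′) ′)
  where open Zroupoid A

𝒮ℒ : Class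
𝒮ℒ A = IZ A × (∀ x → x ′ ≡ x) × (∀ x y → x ⇒ y ≡ y ⇒ x)
  where open Zroupoid A

ℬ𝒜 : Class
ℬ𝒜 A = IZ A × (∀ x y → (x ⇒ y) ⇒ x ≡ x) × (∀ x → x ⇒ x ≡ 𝟎 ′)
  where open Zroupoid A

𝒜₁₂ : Class
𝒜₁₂ A = 𝒮 A × (∀ x y z → x ⇒ (x ⇒ (y ⇒ z)) ≡ x ⇒ ((x ⇒ y) ⇒ z))
  where open Zroupoid A

𝒜₂₃ : Class
𝒜₂₃ A = 𝒮 A × (∀ x y z → x ⇒ ((x ⇒ y) ⇒ z) ≡ (x ⇒ x) ⇒ (y ⇒ z))
  where open Zroupoid A

ℱ₂₅ : Class
ℱ₂₅ A = 𝒮 A × (∀ x y z → x ⇒ ((y ⇒ z) ⇒ z) ≡ ((x ⇒ y) ⇒ z) ⇒ z)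
  where open Zroupoid A

module Submission where

-- Writing x ∨ y := x′ → y, an algebra in 𝒮 becomes a commutative operation with unit 0
-- distributing over its De Morgan dual x ∧ y := (x′ ∨ y′)′, and → is x′ ∨ y.  The heart
-- of the matter is that ∨ is then idempotent and associative: the algebra splits into
-- components of elements with equal τ x = 0′ ∨ x, each a distributive lattice, and the
-- values of τ form a semilattice.  In these terms (A₁₂) says u ∨ u′ ∧ w = u ∨ w and (A₂₃)
-- gives u ∨ u′ ∧ w = (u′ ∧ u) ∨ w.  Since (y → z) → z = z ∨ z′ ∧ y, either one turns
-- both sides of (F₂₅) into the same join, and together they force u′ = u, i.e. 𝒮ℒ.
-- A Boolean algebra has u ∨ u′ = 0′, which gives (A₁₂).  The strict inclusions are
-- witnessed by four small models, checked by computation.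

open import Defs
open import Data.Fin using (Fin; zero; suc; #_; _≟_)
open import Data.Fin.Properties using (all?)
open import Data.Nat using (ℕ; suc)
open import Data.Product using (_×_; _,_; proj₁; proj₂)
open import Data.Vec using (Vec; []; _∷_; lookup)
open import Function using (id; _∘_)
open import Relation.Binary.PropositionalEquality
open import Relation.Nullary using (¬_)
open import Relation.Nullary.Decidable using (Dec; _×-dec_; toWitness; toWitnessFalse)

record DeMorganBimagma : Set₁ where
  infixr 6 _∨_
  infixr 7 _∧_
  infix 8 ~_
  field
    Carrier : Set
    _∨_     : Carrier → Carrier → Carrier
    ~_      : Carrier → Carrier
    ⊥       : Carrier

  _∧_ : Carrier → Carrier → Carrier
  x ∧ y = ~ (~ x ∨ ~ y)

  ⊤ : Carrier
  ⊤ = ~ ⊥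

  field
    ~-involutive : ∀ x → ~ ~ x ≡ x
    ∨-comm       : ∀ x y → x ∨ y ≡ y ∨ x
    ∨-identityʳ  : ∀ x → x ∨ ⊥ ≡ x
    ∨-distribˡ-∧ : ∀ x y z → x ∨ y ∧ z ≡ (x ∨ y) ∧ (x ∨ z)

module DeMorganBimagmaProperties (B : DeMorganBimagma) where
  open DeMorganBimagma B
  open ≡-Reasoning

  ~-injective : ∀ {x y} → ~ x ≡ ~ y → x ≡ y
  ~-injective {x} {y} e = begin
    x     ≡⟨ sym (~-involutive x) ⟩
    ~ ~ x ≡⟨ cong ~_ e ⟩
    ~ ~ y ≡⟨ ~-involutive y ⟩
    y     ∎

  ~-∨ : ∀ x y → ~ (x ∨ y) ≡ ~ x ∧ ~ y
  ~-∨ x y = sym (cong ~_ (cong₂ _∨_ (~-involutive x) (~-involutive y)))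

  ~-∧ : ∀ x y → ~ (x ∧ y) ≡ ~ x ∨ ~ y
  ~-∧ x y = ~-involutive (~ x ∨ ~ y)

  ∧-comm : ∀ x y → x ∧ y ≡ y ∧ x
  ∧-comm x y = cong ~_ (∨-comm (~ x) (~ y))

  ∨-identityˡ : ∀ x → ⊥ ∨ x ≡ x
  ∨-identityˡ x = trans (∨-comm ⊥ x) (∨-identityʳ x)

  ∧-identityʳ : ∀ x → x ∧ ⊤ ≡ x
  ∧-identityʳ x = begin
    ~ (~ x ∨ ~ ~ ⊥) ≡⟨ cong (λ t → ~ (~ x ∨ t)) (~-involutive ⊥) ⟩
    ~ (~ x ∨ ⊥)     ≡⟨ cong ~_ (∨-identityʳ (~ x)) ⟩
    ~ ~ x           ≡⟨ ~-involutive x ⟩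
    x               ∎

  ∧-identityˡ : ∀ x → ⊤ ∧ x ≡ x
  ∧-identityˡ x = trans (∧-comm ⊤ x) (∧-identityʳ x)

  ∧-distribˡ-∨ : ∀ x y z → x ∧ (y ∨ z) ≡ x ∧ y ∨ x ∧ z
  ∧-distribˡ-∨ x y z = ~-injective (begin
    ~ (x ∧ (y ∨ z))               ≡⟨ ~-∧ x (y ∨ z) ⟩
    ~ x ∨ ~ (y ∨ z)               ≡⟨ cong (~ x ∨_) (~-∨ y z) ⟩
    ~ x ∨ ~ y ∧ ~ z               ≡⟨ ∨-distribˡ-∧ (~ x) (~ y) (~ z) ⟩
    (~ x ∨ ~ y) ∧ (~ x ∨ ~ z)     ≡⟨ sym (cong₂ _∧_ (~-∧ x y) (~-∧ x z)) ⟩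
    ~ (x ∧ y) ∧ ~ (x ∧ z)         ≡⟨ sym (~-∨ (x ∧ y) (x ∧ z)) ⟩
    ~ (x ∧ y ∨ x ∧ z)             ∎)

  ⊤∨⊤ : ⊤ ∨ ⊤ ≡ ⊤
  ⊤∨⊤ = begin
    ⊤ ∨ ⊤             ≡⟨ sym (∧-identityˡ (⊤ ∨ ⊤)) ⟩
    ⊤ ∧ (⊤ ∨ ⊤)       ≡⟨ cong (_∧ (⊤ ∨ ⊤)) (sym (∨-identityʳ ⊤)) ⟩
    (⊤ ∨ ⊥) ∧ (⊤ ∨ ⊤) ≡⟨ sym (∨-distribˡ-∧ ⊤ ⊥ ⊤) ⟩
    ⊤ ∨ ⊥ ∧ ⊤         ≡⟨ cong (⊤ ∨_) (∧-identityʳ ⊥) ⟩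
    ⊤ ∨ ⊥             ≡⟨ ∨-identityʳ ⊤ ⟩
    ⊤                 ∎

  ∧-idem : ∀ x → x ∧ x ≡ x
  ∧-idem x = begin
    x ∧ x             ≡⟨ sym (cong₂ _∧_ (∨-identityʳ x) (∨-identityʳ x)) ⟩
    (x ∨ ⊥) ∧ (x ∨ ⊥) ≡⟨ sym (∨-distribˡ-∧ x ⊥ ⊥) ⟩
    x ∨ ~ (⊤ ∨ ⊤)     ≡⟨ cong (λ t → x ∨ ~ t) ⊤∨⊤ ⟩
    x ∨ ~ ~ ⊥         ≡⟨ cong (x ∨_) (~-involutive ⊥) ⟩
    x ∨ ⊥             ≡⟨ ∨-identityʳ x ⟩
    x                 ∎

  ∨-idem : ∀ x → x ∨ x ≡ x
  ∨-idem x = ~-injective (trans (~-∨ x x) (∧-idem (~ x)))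

  ∨-∧-absorb : ∀ x y → x ∨ x ∧ y ≡ x ∧ (x ∨ y)
  ∨-∧-absorb x y = trans (∨-distribˡ-∧ x x y) (cong (_∧ (x ∨ y)) (∨-idem x))

  ∧-⊤∨ : ∀ x y → x ∧ (⊤ ∨ y) ≡ x ∧ (x ∨ y)
  ∧-⊤∨ x y = begin
    x ∧ (⊤ ∨ y)   ≡⟨ ∧-distribˡ-∨ x ⊤ y ⟩
    x ∧ ⊤ ∨ x ∧ y ≡⟨ cong (_∨ x ∧ y) (∧-identityʳ x) ⟩
    x ∨ x ∧ y     ≡⟨ ∨-∧-absorb x y ⟩
    x ∧ (x ∨ y)   ∎

  ∨-⊥∧ : ∀ x y → x ∨ ⊥ ∧ y ≡ x ∧ (x ∨ y)
  ∨-⊥∧ x y = trans (∨-distribˡ-∧ x ⊥ y) (cong (_∧ (x ∨ y)) (∨-identityʳ x))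

  ⊥∧⊤∨ : ∀ y → ⊥ ∧ (⊤ ∨ y) ≡ ⊥ ∧ y
  ⊥∧⊤∨ y = trans (∧-⊤∨ ⊥ y) (cong (⊥ ∧_) (∨-identityˡ y))

  ∧-∨-⊤∨ : ∀ x y → x ∧ (x ∨ (⊤ ∨ y)) ≡ x ∧ (⊤ ∨ y)
  ∧-∨-⊤∨ x y = begin
    x ∧ (x ∨ (⊤ ∨ y)) ≡⟨ sym (∨-⊥∧ x (⊤ ∨ y)) ⟩
    x ∨ ⊥ ∧ (⊤ ∨ y)   ≡⟨ cong (x ∨_) (⊥∧⊤∨ y) ⟩
    x ∨ ⊥ ∧ y         ≡⟨ ∨-⊥∧ x y ⟩
    x ∧ (x ∨ y)       ≡⟨ sym (∧-⊤∨ x y) ⟩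
    x ∧ (⊤ ∨ y)       ∎

  ∨-∧-∨ : ∀ x y → x ∨ y ∧ (x ∨ y) ≡ x ∨ y
  ∨-∧-∨ x y = begin
    x ∨ y ∧ (x ∨ y)             ≡⟨ ∨-distribˡ-∧ x y (x ∨ y) ⟩
    (x ∨ y) ∧ (x ∨ (x ∨ y))     ≡⟨ cong ((x ∨ y) ∧_) (∨-comm x (x ∨ y)) ⟩
    (x ∨ y) ∧ ((x ∨ y) ∨ x)     ≡⟨ sym (∧-⊤∨ (x ∨ y) x) ⟩
    (x ∨ y) ∧ (⊤ ∨ x)           ≡⟨ cong ((x ∨ y) ∧_) (∨-comm ⊤ x) ⟩
    (x ∨ y) ∧ (x ∨ ⊤)           ≡⟨ sym (∨-distribˡ-∧ x y ⊤) ⟩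
    x ∨ y ∧ ⊤                   ≡⟨ cong (x ∨_) (∧-identityʳ y) ⟩
    x ∨ y                       ∎

  ⊤∨-∨ : ∀ x y → (⊤ ∨ x) ∨ y ≡ ⊤ ∨ x ∧ y
  ⊤∨-∨ x y = begin
    a ∨ y             ≡⟨ sym (∨-∧-∨ a y) ⟩
    a ∨ y ∧ (a ∨ y)   ≡⟨ cong (λ t → a ∨ y ∧ t) (∨-comm a y) ⟩
    a ∨ y ∧ (y ∨ a)   ≡⟨ cong (a ∨_) (∧-∨-⊤∨ y x) ⟩
    a ∨ y ∧ a         ≡⟨ cong (a ∨_) (∧-comm y a) ⟩
    a ∨ a ∧ y         ≡⟨ ∨-∧-absorb a y ⟩
    a ∧ (a ∨ y)       ≡⟨ sym (∧-⊤∨ a y) ⟩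
    a ∧ (⊤ ∨ y)       ≡⟨ sym (∨-distribˡ-∧ ⊤ x y) ⟩
    ⊤ ∨ x ∧ y         ∎
    where
    a = ⊤ ∨ x

  ⊥∧-∧ : ∀ x y → (⊥ ∧ x) ∧ y ≡ ⊥ ∧ (x ∨ y)
  ⊥∧-∧ x y = ~-injective (begin
    ~ ((⊥ ∧ x) ∧ y)   ≡⟨ ~-∧ (⊥ ∧ x) y ⟩
    ~ (⊥ ∧ x) ∨ ~ y   ≡⟨ cong (_∨ ~ y) (~-∧ ⊥ x) ⟩
    (⊤ ∨ ~ x) ∨ ~ y   ≡⟨ ⊤∨-∨ (~ x) (~ y) ⟩
    ⊤ ∨ ~ x ∧ ~ y     ≡⟨ cong (⊤ ∨_) (sym (~-∨ x y)) ⟩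
    ⊤ ∨ ~ (x ∨ y)     ≡⟨ sym (~-∧ ⊥ (x ∨ y)) ⟩
    ~ (⊥ ∧ (x ∨ y))   ∎)

  ⊤∨-assoc : ∀ x y → ⊤ ∨ (x ∨ y) ≡ (⊤ ∨ x) ∨ y
  ⊤∨-assoc x y = begin
    ⊤ ∨ (x ∨ y)       ≡⟨ sym (∧-identityˡ (⊤ ∨ (x ∨ y))) ⟩
    ⊤ ∧ (⊤ ∨ (x ∨ y)) ≡⟨ sym (∨-⊥∧ ⊤ (x ∨ y)) ⟩
    ⊤ ∨ ⊥ ∧ (x ∨ y)   ≡⟨ cong (⊤ ∨_) (sym (⊥∧-∧ x y)) ⟩
    ⊤ ∨ (⊥ ∧ x) ∧ y   ≡⟨ sym (⊤∨-∨ (⊥ ∧ x) y) ⟩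
    (⊤ ∨ ⊥ ∧ x) ∨ y   ≡⟨ cong (_∨ y) (sym (⊤∨-∨ ⊥ x)) ⟩
    ((⊤ ∨ ⊥) ∨ x) ∨ y ≡⟨ cong (λ t → (t ∨ x) ∨ y) (∨-identityʳ ⊤) ⟩
    (⊤ ∨ x) ∨ y       ∎

  -- τ x is the top of the component of x; on tops ∨ and ∧ agree.
  τ : Carrier → Carrier
  τ x = ⊤ ∨ x

  τ-idem : ∀ x → τ (τ x) ≡ τ x
  τ-idem x = trans (⊤∨-assoc ⊤ x) (cong (_∨ x) ⊤∨⊤)

  τ-∧ : ∀ x y → τ (x ∧ y) ≡ τ x ∧ τ y
  τ-∧ = ∨-distribˡ-∧ ⊤

  τ-∨ : ∀ x y → τ (x ∨ y) ≡ τ x ∨ τ y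
  τ-∨ x y = begin
    τ (x ∨ y)       ≡⟨ ⊤∨-assoc x y ⟩
    τ x ∨ y         ≡⟨ ⊤∨-∨ x y ⟩
    τ (x ∧ y)       ≡⟨ τ-∧ x y ⟩
    τ x ∧ τ y       ≡⟨ cong (τ x ∧_) (sym (τ-idem y)) ⟩
    τ x ∧ τ (τ y)   ≡⟨ sym (τ-∧ x (τ y)) ⟩
    τ (x ∧ τ y)     ≡⟨ sym (⊤∨-∨ x (τ y)) ⟩
    τ x ∨ τ y       ∎

  ∧-τ : ∀ x → x ∧ τ x ≡ x
  ∧-τ x = begin
    x ∧ (⊤ ∨ x) ≡⟨ ∧-⊤∨ x x ⟩
    x ∧ (x ∨ x) ≡⟨ cong (x ∧_) (∨-idem x) ⟩
    x ∧ x       ≡⟨ ∧-idem x ⟩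
    x           ∎

  IsTop : Carrier → Set
  IsTop p = τ p ≡ p

  τ-isTop : ∀ x → IsTop (τ x)
  τ-isTop = τ-idem

  ∨-isTop : ∀ {p q} → IsTop p → IsTop q → IsTop (p ∨ q)
  ∨-isTop {p} {q} tp tq = trans (τ-∨ p q) (cong₂ _∨_ tp tq)

  top-∨≡∧ : ∀ {p q} → IsTop p → IsTop q → p ∨ q ≡ p ∧ q
  top-∨≡∧ {p} {q} tp tq = begin
    p ∨ q     ≡⟨ cong (_∨ q) (sym tp) ⟩
    τ p ∨ q   ≡⟨ ⊤∨-∨ p q ⟩
    τ (p ∧ q) ≡⟨ τ-∧ p q ⟩
    τ p ∧ τ q ≡⟨ cong₂ _∧_ tp tq ⟩
    p ∧ q     ∎

  top-∨-absorb : ∀ {p q} → IsTop p → IsTop q → p ∨ (p ∨ q) ≡ p ∨ q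
  top-∨-absorb {p} {q} tp tq = begin
    p ∨ (p ∨ q) ≡⟨ top-∨≡∧ tp (∨-isTop tp tq) ⟩
    p ∧ (p ∨ q) ≡⟨ sym (∧-⊤∨ p q) ⟩
    p ∧ τ q     ≡⟨ cong (p ∧_) tq ⟩
    p ∧ q       ≡⟨ sym (top-∨≡∧ tp tq) ⟩
    p ∨ q       ∎

  top-∨-distribˡ : ∀ {p q r} → IsTop p → IsTop q → IsTop r → p ∨ (q ∨ r) ≡ (p ∨ q) ∨ (p ∨ r)
  top-∨-distribˡ {p} {q} {r} tp tq tr = begin
    p ∨ (q ∨ r)       ≡⟨ cong (p ∨_) (top-∨≡∧ tq tr) ⟩
    p ∨ q ∧ r         ≡⟨ ∨-distribˡ-∧ p q r ⟩
    (p ∨ q) ∧ (p ∨ r) ≡⟨ sym (top-∨≡∧ (∨-isTop tp tq) (∨-isTop tp tr)) ⟩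
    (p ∨ q) ∨ (p ∨ r) ∎

  top-∨-assoc : ∀ {p q r} → IsTop p → IsTop q → IsTop r → p ∨ (q ∨ r) ≡ (p ∨ q) ∨ r
  top-∨-assoc {p} {q} {r} tp tq tr = begin
    p ∨ (q ∨ r)                   ≡⟨ top-∨-distribˡ tp tq tr ⟩
    (p ∨ q) ∨ (p ∨ r)             ≡⟨ top-∨-distribˡ tpq tp tr ⟩
    ((p ∨ q) ∨ p) ∨ ((p ∨ q) ∨ r) ≡⟨ cong (_∨ ((p ∨ q) ∨ r)) pqp ⟩
    (p ∨ q) ∨ ((p ∨ q) ∨ r)       ≡⟨ top-∨-absorb tpq tr ⟩
    (p ∨ q) ∨ r                   ∎
    where
    tpq = ∨-isTop tp tq
    pqp : (p ∨ q) ∨ p ≡ p ∨ q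
    pqp = trans (∨-comm (p ∨ q) p) (top-∨-absorb tp tq)

  top-∨-exch : ∀ {p q r} → IsTop p → IsTop q → IsTop r → p ∨ (q ∨ r) ≡ q ∨ (p ∨ r)
  top-∨-exch {p} {q} {r} tp tq tr = begin
    p ∨ (q ∨ r) ≡⟨ top-∨-assoc tp tq tr ⟩
    (p ∨ q) ∨ r ≡⟨ cong (_∨ r) (∨-comm p q) ⟩
    (q ∨ p) ∨ r ≡⟨ sym (top-∨-assoc tq tp tr) ⟩
    q ∨ (p ∨ r) ∎

  -- On a single component (elements with the same τ) ∧ absorbs ∨, so ≤ is a lattice order there.
  infix 4 _≤_
  _≤_ : Carrier → Carrier → Set
  x ≤ y = x ∧ y ≡ x

  ≤-refl : ∀ x → x ≤ x
  ≤-refl = ∧-idem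

  ≤-antisym : ∀ {x y} → x ≤ y → y ≤ x → x ≡ y
  ≤-antisym {x} {y} x≤y y≤x = trans (sym x≤y) (trans (∧-comm x y) y≤x)

  ∨-lub : ∀ {x y z} → x ≤ z → y ≤ z → x ∨ y ≤ z
  ∨-lub {x} {y} {z} x≤z y≤z = begin
    (x ∨ y) ∧ z   ≡⟨ ∧-comm (x ∨ y) z ⟩
    z ∧ (x ∨ y)   ≡⟨ ∧-distribˡ-∨ z x y ⟩
    z ∧ x ∨ z ∧ y ≡⟨ cong₂ _∨_ (trans (∧-comm z x) x≤z) (trans (∧-comm z y) y≤z) ⟩
    x ∨ y         ∎

  ∨-∧-absorb-component : ∀ {x y} → τ y ≡ τ x → x ∨ x ∧ y ≡ x
  ∨-∧-absorb-component {x} {y} e = begin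
    x ∨ x ∧ y   ≡⟨ ∨-∧-absorb x y ⟩
    x ∧ (x ∨ y) ≡⟨ sym (∧-⊤∨ x y) ⟩
    x ∧ τ y     ≡⟨ cong (x ∧_) e ⟩
    x ∧ τ x     ≡⟨ ∧-τ x ⟩
    x           ∎

  ≤-∨ʳ : ∀ {x y z} → τ y ≡ τ x → x ≤ z → x ≤ z ∨ y
  ≤-∨ʳ {x} {y} {z} e x≤z = begin
    x ∧ (z ∨ y)   ≡⟨ ∧-distribˡ-∨ x z y ⟩
    x ∧ z ∨ x ∧ y ≡⟨ cong (_∨ x ∧ y) x≤z ⟩
    x ∨ x ∧ y     ≡⟨ ∨-∧-absorb-component e ⟩
    x             ∎

  ≤-∨ˡ : ∀ {x y z} → τ y ≡ τ x → x ≤ z → x ≤ y ∨ z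
  ≤-∨ˡ {x} {y} {z} e x≤z = trans (cong (x ∧_) (∨-comm y z)) (≤-∨ʳ e x≤z)

  ∨-assoc-component : ∀ {x y z} → τ y ≡ τ x → τ z ≡ τ x → x ∨ (y ∨ z) ≡ (x ∨ y) ∨ z
  ∨-assoc-component {x} {y} {z} yx zx = ≤-antisym
    (∨-lub (≤-∨ʳ zx (≤-∨ʳ yx (≤-refl x)))
           (∨-lub (≤-∨ʳ zy (≤-∨ˡ xy (≤-refl y)))
                  (≤-∨ˡ xyz (≤-refl z))))
    (∨-lub (∨-lub (≤-∨ʳ yzx (≤-refl x))
                  (≤-∨ˡ xy (≤-∨ʳ zy (≤-refl y))))
           (≤-∨ˡ xz (≤-∨ˡ yz (≤-refl z))))
    where
    xy = sym yx
    xz = sym zx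
    zy = trans zx xy
    yz = trans yx xz
    xyz : τ (x ∨ y) ≡ τ z
    xyz = trans (τ-∨ x y) (trans (cong (τ x ∨_) yx) (trans (∨-idem (τ x)) (sym zx)))
    yzx : τ (y ∨ z) ≡ τ x
    yzx = trans (τ-∨ y z) (trans (cong₂ _∨_ yx zx) (∨-idem (τ x)))

  ∨-assoc : ∀ x y z → x ∨ (y ∨ z) ≡ (x ∨ y) ∨ z
  ∨-assoc x y z = begin
    x ∨ (y ∨ z)             ≡⟨ sym (restrict τ-left) ⟩
    t ∧ (x ∨ (y ∨ z))       ≡⟨ ∧-distribˡ-∨ t x (y ∨ z) ⟩
    t ∧ x ∨ t ∧ (y ∨ z)     ≡⟨ cong (t ∧ x ∨_) (∧-distribˡ-∨ t y z) ⟩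
    t ∧ x ∨ (t ∧ y ∨ t ∧ z) ≡⟨ ∨-assoc-component (same-component y↑) (same-component z↑) ⟩
    (t ∧ x ∨ t ∧ y) ∨ t ∧ z ≡⟨ cong (_∨ t ∧ z) (sym (∧-distribˡ-∨ t x y)) ⟩
    t ∧ (x ∨ y) ∨ t ∧ z     ≡⟨ sym (∧-distribˡ-∨ t (x ∨ y) z) ⟩
    t ∧ ((x ∨ y) ∨ z)       ≡⟨ restrict τ-right ⟩
    (x ∨ y) ∨ z             ∎
    where
    tx = τ-isTop x
    ty = τ-isTop y
    tz = τ-isTop z
    tyz = ∨-isTop ty tz
    t = τ x ∨ (τ y ∨ τ z)
    tt : IsTop t
    tt = ∨-isTop tx tyz

    τ-left : τ (x ∨ (y ∨ z)) ≡ t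
    τ-left = trans (τ-∨ x (y ∨ z)) (cong (τ x ∨_) (τ-∨ y z))

    τ-right : τ ((x ∨ y) ∨ z) ≡ t
    τ-right = begin
      τ ((x ∨ y) ∨ z)       ≡⟨ τ-∨ (x ∨ y) z ⟩
      τ (x ∨ y) ∨ τ z       ≡⟨ cong (_∨ τ z) (τ-∨ x y) ⟩
      (τ x ∨ τ y) ∨ τ z     ≡⟨ sym (top-∨-assoc tx ty tz) ⟩
      t                     ∎

    restrict : ∀ {w} → τ w ≡ t → t ∧ w ≡ w
    restrict {w} e = trans (∧-comm t w) (trans (cong (w ∧_) (sym e)) (∧-τ w))

    x↑ : τ x ∨ t ≡ t
    x↑ = top-∨-absorb tx tyz

    y↑ : τ y ∨ t ≡ t
    y↑ = trans (top-∨-exch ty tx tyz) (cong (τ x ∨_) (top-∨-absorb ty tz))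

    z↑ : τ z ∨ t ≡ t
    z↑ = begin
      τ z ∨ (τ x ∨ (τ y ∨ τ z)) ≡⟨ top-∨-exch tz tx tyz ⟩
      τ x ∨ (τ z ∨ (τ y ∨ τ z)) ≡⟨ cong (τ x ∨_) (top-∨-exch tz ty tz) ⟩
      τ x ∨ (τ y ∨ (τ z ∨ τ z)) ≡⟨ cong (λ s → τ x ∨ (τ y ∨ s)) (∨-idem (τ z)) ⟩
      t                         ∎

    lift : ∀ {v} → τ v ∨ t ≡ t → τ (t ∧ v) ≡ t
    lift {v} e = begin
      τ (t ∧ v)   ≡⟨ τ-∧ t v ⟩
      τ t ∧ τ v   ≡⟨ cong (_∧ τ v) tt ⟩
      t ∧ τ v     ≡⟨ ∧-comm t (τ v) ⟩
      τ v ∧ t     ≡⟨ sym (top-∨≡∧ (τ-isTop v) tt) ⟩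
      τ v ∨ t     ≡⟨ e ⟩
      t           ∎

    same-component : ∀ {w} → τ w ∨ t ≡ t → τ (t ∧ w) ≡ τ (t ∧ x)
    same-component e = trans (lift e) (sym (lift x↑))

  ∨-exch : ∀ x y z → x ∨ (y ∨ z) ≡ y ∨ (x ∨ z)
  ∨-exch x y z = begin
    x ∨ (y ∨ z) ≡⟨ ∨-assoc x y z ⟩
    (x ∨ y) ∨ z ≡⟨ cong (_∨ z) (∨-comm x y) ⟩
    (y ∨ x) ∨ z ≡⟨ sym (∨-assoc y x z) ⟩
    y ∨ (x ∨ z) ∎

  ∨-absorbˡ : ∀ x y → x ∨ (x ∨ y) ≡ x ∨ y
  ∨-absorbˡ x y = trans (∨-assoc x x y) (cong (_∨ y) (∨-idem x))

A₁₂-law A₂₃-law F₂₅-law : Zroupoid → Set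
A₁₂-law A = ∀ x y z → x ⇒ (x ⇒ (y ⇒ z)) ≡ x ⇒ ((x ⇒ y) ⇒ z)
  where open Zroupoid A
A₂₃-law A = ∀ x y z → x ⇒ ((x ⇒ y) ⇒ z) ≡ (x ⇒ x) ⇒ (y ⇒ z)
  where open Zroupoid A
F₂₅-law A = ∀ x y z → x ⇒ ((y ⇒ z) ⇒ z) ≡ ((x ⇒ y) ⇒ z) ⇒ z
  where open Zroupoid A

module 𝒮-Properties {A : Zroupoid} (𝒮A : 𝒮 A) where
  open Zroupoid A
  open ≡-Reasoning

  law-I : ∀ x y z → (x ⇒ y) ⇒ z ≡ ((z ′ ⇒ x) ⇒ (y ⇒ z) ′) ′
  law-I = proj₁ (proj₁ 𝒮A)

  ′-involutive : ∀ x → x ′ ′ ≡ x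
  ′-involutive = proj₁ (proj₂ 𝒮A)

  ′-⇒-sym : ∀ x y → (x ⇒ y ′) ′ ≡ (y ⇒ x ′) ′
  ′-⇒-sym = proj₂ (proj₂ 𝒮A)

  contraposition : ∀ x y → x ⇒ y ≡ y ′ ⇒ x ′
  contraposition x y = begin
    x ⇒ y           ≡⟨ cong (x ⇒_) (sym (′-involutive y)) ⟩
    x ⇒ y ′ ′       ≡⟨ sym (′-involutive (x ⇒ y ′ ′)) ⟩
    (x ⇒ y ′ ′) ′ ′ ≡⟨ cong _′ (′-⇒-sym x (y ′)) ⟩
    (y ′ ⇒ x ′) ′ ′ ≡⟨ ′-involutive (y ′ ⇒ x ′) ⟩
    y ′ ⇒ x ′       ∎

  ′⇒-comm : ∀ x y → x ′ ⇒ y ≡ y ′ ⇒ x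
  ′⇒-comm x y = trans (contraposition (x ′) y) (cong (y ′ ⇒_) (′-involutive x))

  ′⇒-distrib : ∀ x y z → x ′ ⇒ (y ′ ′ ⇒ z ′) ′ ≡ ((x ′ ⇒ y) ′ ′ ⇒ (x ′ ⇒ z) ′) ′
  ′⇒-distrib x y z = begin
    x ′ ⇒ (y ′ ′ ⇒ z ′) ′         ≡⟨ cong (λ t → x ′ ⇒ (t ⇒ z ′) ′) (′-involutive y) ⟩
    x ′ ⇒ (y ⇒ z ′) ′             ≡⟨ contraposition (x ′) ((y ⇒ z ′) ′) ⟩
    (y ⇒ z ′) ′ ′ ⇒ x ′ ′         ≡⟨ cong₂ _⇒_ (′-involutive (y ⇒ z ′)) (′-involutive x) ⟩
    (y ⇒ z ′) ⇒ x                 ≡⟨ law-I y (z ′) x ⟩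
    ((x ′ ⇒ y) ⇒ (z ′ ⇒ x) ′) ′   ≡⟨ cong (λ t → ((x ′ ⇒ y) ⇒ t ′) ′) (′⇒-comm z x) ⟩
    ((x ′ ⇒ y) ⇒ (x ′ ⇒ z) ′) ′   ≡⟨ cong (λ t → (t ⇒ (x ′ ⇒ z) ′) ′) (sym (′-involutive (x ′ ⇒ y))) ⟩
    ((x ′ ⇒ y) ′ ′ ⇒ (x ′ ⇒ z) ′) ′ ∎

  bimagma : DeMorganBimagma
  bimagma = record
    { Carrier      = Carrier
    ; _∨_          = λ x y → x ′ ⇒ y
    ; ~_           = _′
    ; ⊥            = 𝟎
    ; ~-involutive = ′-involutive
    ; ∨-comm       = ′⇒-comm
    ; ∨-identityʳ  = ′-involutive
    ; ∨-distribˡ-∧ = ′⇒-distrib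
    }

  open DeMorganBimagma bimagma public using (_∨_; _∧_; ~_; ⊥; ⊤; ∨-comm; ∨-identityʳ; ∨-distribˡ-∧)
  open DeMorganBimagmaProperties bimagma public

  ⇒-as-∨ : ∀ x y → x ⇒ y ≡ ~ x ∨ y
  ⇒-as-∨ x y = cong (_⇒ y) (sym (′-involutive x))

  ⇒-self-as-∨ : ∀ y z → (y ⇒ z) ⇒ z ≡ z ∨ ~ z ∧ y
  ⇒-self-as-∨ y z = begin
    (y ⇒ z) ⇒ z       ≡⟨ ⇒-as-∨ (y ⇒ z) z ⟩
    ~ (y ⇒ z) ∨ z     ≡⟨ cong (λ t → ~ t ∨ z) (⇒-as-∨ y z) ⟩
    ~ (~ y ∨ z) ∨ z   ≡⟨ ∨-comm (~ (~ y ∨ z)) z ⟩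
    z ∨ ~ (~ y ∨ z)   ≡⟨ cong (z ∨_) (~-∨ (~ y) z) ⟩
    z ∨ ~ ~ y ∧ ~ z   ≡⟨ cong (λ t → z ∨ t ∧ ~ z) (′-involutive y) ⟩
    z ∨ y ∧ ~ z       ≡⟨ cong (z ∨_) (∧-comm y (~ z)) ⟩
    z ∨ ~ z ∧ y       ∎

  ~∧-Absorptive : Set
  ~∧-Absorptive = ∀ u w → u ∨ ~ u ∧ w ≡ u ∨ w

  F₂₅-law-from : (c : Carrier → Carrier) → (∀ u w → u ∨ ~ u ∧ w ≡ c u ∨ w) → F₂₅-law A
  F₂₅-law-from c translate x y z = begin
    x ⇒ ((y ⇒ z) ⇒ z)   ≡⟨ ⇒-as-∨ x ((y ⇒ z) ⇒ z) ⟩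
    ~ x ∨ ((y ⇒ z) ⇒ z) ≡⟨ cong (~ x ∨_) (⇒-self-as-∨ y z) ⟩
    ~ x ∨ (z ∨ ~ z ∧ y) ≡⟨ cong (~ x ∨_) (translate z y) ⟩
    ~ x ∨ (c z ∨ y)     ≡⟨ ∨-exch (~ x) (c z) y ⟩
    c z ∨ (~ x ∨ y)     ≡⟨ cong (c z ∨_) (sym (⇒-as-∨ x y)) ⟩
    c z ∨ (x ⇒ y)       ≡⟨ sym (translate z (x ⇒ y)) ⟩
    z ∨ ~ z ∧ (x ⇒ y)   ≡⟨ sym (⇒-self-as-∨ (x ⇒ y) z) ⟩
    ((x ⇒ y) ⇒ z) ⇒ z   ∎

  ∨-~∧ : ∀ u w → u ∨ ~ u ∧ w ≡ u ∨ ~ (u ∨ ~ w)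
  ∨-~∧ u w = begin
    u ∨ ~ u ∧ w       ≡⟨ cong (λ t → u ∨ ~ u ∧ t) (sym (′-involutive w)) ⟩
    u ∨ ~ u ∧ ~ ~ w   ≡⟨ cong (u ∨_) (sym (~-∨ u (~ w))) ⟩
    u ∨ ~ (u ∨ ~ w)   ∎

  A₁₂→~∧-absorptive : A₁₂-law A → ~∧-Absorptive
  A₁₂→~∧-absorptive a₁₂ u w = begin
    u ∨ ~ u ∧ w       ≡⟨ ∨-~∧ u w ⟩
    u ∨ ~ (u ∨ ~ w)   ≡⟨ sym (a₁₂ (~ u) (~ w) ⊥) ⟩
    u ∨ (u ∨ (w ∨ ⊥)) ≡⟨ cong (λ t → u ∨ (u ∨ t)) (∨-identityʳ w) ⟩
    u ∨ (u ∨ w)       ≡⟨ ∨-absorbˡ u w ⟩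
    u ∨ w             ∎

  ~∧-absorptive→A₁₂ : ~∧-Absorptive → A₁₂-law A
  ~∧-absorptive→A₁₂ absorptive x y z = begin
    x ⇒ (x ⇒ (y ⇒ z))         ≡⟨ ⇒-as-∨ x (x ⇒ (y ⇒ z)) ⟩
    ~ x ∨ (x ⇒ (y ⇒ z))       ≡⟨ cong (~ x ∨_) (trans (⇒-as-∨ x (y ⇒ z)) (cong (~ x ∨_) (⇒-as-∨ y z))) ⟩
    ~ x ∨ (~ x ∨ (~ y ∨ z))   ≡⟨ ∨-absorbˡ (~ x) (~ y ∨ z) ⟩
    ~ x ∨ (~ y ∨ z)           ≡⟨ ∨-assoc (~ x) (~ y) z ⟩
    (~ x ∨ ~ y) ∨ z           ≡⟨ cong (_∨ z) (sym (absorptive (~ x) (~ y))) ⟩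
    (~ x ∨ ~ ~ x ∧ ~ y) ∨ z   ≡⟨ cong (λ t → (~ x ∨ t) ∨ z) (sym (~-∨ (~ x) y)) ⟩
    (~ x ∨ ~ (~ x ∨ y)) ∨ z   ≡⟨ sym (∨-assoc (~ x) (~ (~ x ∨ y)) z) ⟩
    ~ x ∨ (~ (~ x ∨ y) ∨ z)   ≡⟨ cong (λ t → ~ x ∨ (~ t ∨ z)) (sym (⇒-as-∨ x y)) ⟩
    ~ x ∨ (~ (x ⇒ y) ∨ z)     ≡⟨ cong (~ x ∨_) (sym (⇒-as-∨ (x ⇒ y) z)) ⟩
    ~ x ∨ ((x ⇒ y) ⇒ z)       ≡⟨ sym (⇒-as-∨ x ((x ⇒ y) ⇒ z)) ⟩
    x ⇒ ((x ⇒ y) ⇒ z)         ∎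

  A₂₃→∨-~∧ : A₂₃-law A → ∀ u w → u ∨ ~ u ∧ w ≡ ~ u ∧ u ∨ w
  A₂₃→∨-~∧ a₂₃ u w = begin
    u ∨ ~ u ∧ w           ≡⟨ ∨-~∧ u w ⟩
    u ∨ ~ (u ∨ ~ w)       ≡⟨ a₂₃ (~ u) (~ w) ⊥ ⟩
    (u ∨ ~ u) ⇒ (w ∨ ⊥)   ≡⟨ ⇒-as-∨ (u ∨ ~ u) (w ∨ ⊥) ⟩
    ~ (u ∨ ~ u) ∨ (w ∨ ⊥) ≡⟨ cong₂ _∨_ (~-∨ u (~ u)) (∨-identityʳ w) ⟩
    ~ u ∧ ~ ~ u ∨ w       ≡⟨ cong (λ t → ~ u ∧ t ∨ w) (′-involutive u) ⟩
    ~ u ∧ u ∨ w           ∎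

  A₁₂→A₂₃→′-identity : A₁₂-law A → A₂₃-law A → ∀ x → x ′ ≡ x
  A₁₂→A₂₃→′-identity a₁₂ a₂₃ x = begin
    ~ x           ≡⟨ sym (~∧-self (~ x)) ⟩
    ~ ~ x ∧ ~ x   ≡⟨ cong (_∧ ~ x) (′-involutive x) ⟩
    x ∧ ~ x       ≡⟨ ∧-comm x (~ x) ⟩
    ~ x ∧ x       ≡⟨ ~∧-self x ⟩
    x             ∎
    where
    ~∧-self : ∀ u → ~ u ∧ u ≡ u
    ~∧-self u = begin
      ~ u ∧ u     ≡⟨ sym (∨-identityʳ (~ u ∧ u)) ⟩
      ~ u ∧ u ∨ ⊥ ≡⟨ sym (A₂₃→∨-~∧ a₂₃ u ⊥) ⟩
      u ∨ ~ u ∧ ⊥ ≡⟨ A₁₂→~∧-absorptive a₁₂ u ⊥ ⟩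
      u ∨ ⊥       ≡⟨ ∨-identityʳ u ⟩
      u           ∎

  ⇒-self→~∧-absorptive : (∀ x → x ⇒ x ≡ 𝟎 ′) → ~∧-Absorptive
  ⇒-self→~∧-absorptive ⇒-self u w = begin
    u ∨ ~ u ∧ w         ≡⟨ ∨-distribˡ-∧ u (~ u) w ⟩
    (u ∨ ~ u) ∧ (u ∨ w) ≡⟨ cong (_∧ (u ∨ w)) excluded-middle ⟩
    ⊤ ∧ (u ∨ w)         ≡⟨ ∧-identityˡ (u ∨ w) ⟩
    u ∨ w               ∎
    where
    excluded-middle : u ∨ ~ u ≡ ⊤
    excluded-middle = trans (∨-comm u (~ u)) (trans (sym (⇒-as-∨ u u)) (⇒-self u))

𝒮ℒ⊆𝒮 : 𝒮ℒ ⊆ᶜ 𝒮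
𝒮ℒ⊆𝒮 A (iz , ′-identity , ⇒-comm) = iz , ′-involutive , ′-⇒-sym
  where
  open Zroupoid A
  open ≡-Reasoning

  ′-involutive : ∀ x → x ′ ′ ≡ x
  ′-involutive x = trans (′-identity (x ′)) (′-identity x)

  ′-⇒-sym : ∀ x y → (x ⇒ y ′) ′ ≡ (y ⇒ x ′) ′
  ′-⇒-sym x y = cong _′ (begin
    x ⇒ y ′ ≡⟨ cong (x ⇒_) (′-identity y) ⟩
    x ⇒ y   ≡⟨ ⇒-comm x y ⟩
    y ⇒ x   ≡⟨ cong (y ⇒_) (sym (′-identity x)) ⟩
    y ⇒ x ′ ∎)

module 𝒮ℒ-Properties {A : Zroupoid} (𝒮ℒA : 𝒮ℒ A) where
  open Zroupoid A
  open 𝒮-Properties {A} (𝒮ℒ⊆𝒮 A 𝒮ℒA) using (_∨_; ∨-assoc)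
  open ≡-Reasoning

  ⇒-as-∨ : ∀ x y → x ⇒ y ≡ x ∨ y
  ⇒-as-∨ x y = cong (_⇒ y) (sym (proj₁ (proj₂ 𝒮ℒA) x))

  ⇒-assoc : ∀ x y z → x ⇒ (y ⇒ z) ≡ (x ⇒ y) ⇒ z
  ⇒-assoc x y z = begin
    x ⇒ (y ⇒ z) ≡⟨ trans (⇒-as-∨ x (y ⇒ z)) (cong (x ∨_) (⇒-as-∨ y z)) ⟩
    x ∨ (y ∨ z) ≡⟨ ∨-assoc x y z ⟩
    (x ∨ y) ∨ z ≡⟨ sym (trans (⇒-as-∨ (x ⇒ y) z) (cong (_∨ z) (⇒-as-∨ x y))) ⟩
    (x ⇒ y) ⇒ z ∎

  A₁₂ : A₁₂-law A
  A₁₂ x y z = cong (x ⇒_) (⇒-assoc x y z)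

  A₂₃ : A₂₃-law A
  A₂₃ x y z = trans (sym (A₁₂ x y z)) (⇒-assoc x x (y ⇒ z))

ℬ𝒜⊆𝒮 : ℬ𝒜 ⊆ᶜ 𝒮
ℬ𝒜⊆𝒮 A (iz@(law-I , _) , absorb , _) = iz , ′-involutive , ′-⇒-sym
  where
  open Zroupoid A
  open ≡-Reasoning

  𝟎⇒-′ : ∀ x → (𝟎 ⇒ x) ′ ≡ 𝟎
  𝟎⇒-′ = absorb 𝟎

  ′-involutive : ∀ x → x ′ ′ ≡ x
  ′-involutive x = begin
    x ′ ′                     ≡⟨ cong₂ (λ a b → (a ⇒ b) ′) (sym (absorb x 𝟎)) (sym (𝟎⇒-′ x)) ⟩
    ((x ′ ⇒ x) ⇒ (𝟎 ⇒ x) ′) ′ ≡⟨ sym (law-I x 𝟎 x) ⟩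
    x ′ ⇒ x                   ≡⟨ absorb x 𝟎 ⟩
    x                         ∎

  ′⇒-comm : ∀ x y → x ′ ⇒ y ≡ y ′ ⇒ x
  ′⇒-comm x y = begin
    x ′ ⇒ y                   ≡⟨ sym (′-involutive (x ′ ⇒ y)) ⟩
    (x ′ ⇒ y) ′ ′             ≡⟨ cong (λ b → ((x ′ ⇒ y) ⇒ b) ′) (sym (𝟎⇒-′ x)) ⟩
    ((x ′ ⇒ y) ⇒ (𝟎 ⇒ x) ′) ′ ≡⟨ sym (law-I y 𝟎 x) ⟩
    y ′ ⇒ x                   ∎

  ′-⇒-sym : ∀ x y → (x ⇒ y ′) ′ ≡ (y ⇒ x ′) ′
  ′-⇒-sym x y = cong _′ (begin
    x ⇒ y ′       ≡⟨ cong (_⇒ y ′) (sym (′-involutive x)) ⟩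
    x ′ ′ ⇒ y ′   ≡⟨ ′⇒-comm (x ′) (y ′) ⟩
    y ′ ′ ⇒ x ′   ≡⟨ cong (_⇒ x ′) (′-involutive y) ⟩
    y ⇒ x ′       ∎)

𝒮ℒ⊆𝒜₁₂ : 𝒮ℒ ⊆ᶜ 𝒜₁₂
𝒮ℒ⊆𝒜₁₂ A 𝒮ℒA = 𝒮ℒ⊆𝒮 A 𝒮ℒA , 𝒮ℒ-Properties.A₁₂ {A} 𝒮ℒA

𝒮ℒ⊆𝒜₂₃ : 𝒮ℒ ⊆ᶜ 𝒜₂₃
𝒮ℒ⊆𝒜₂₃ A 𝒮ℒA = 𝒮ℒ⊆𝒮 A 𝒮ℒA , 𝒮ℒ-Properties.A₂₃ {A} 𝒮ℒA

ℬ𝒜⊆𝒜₁₂ : ℬ𝒜 ⊆ᶜ 𝒜₁₂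
ℬ𝒜⊆𝒜₁₂ A ℬ𝒜A@(_ , _ , ⇒-self) = 𝒮A , ~∧-absorptive→A₁₂ (⇒-self→~∧-absorptive ⇒-self)
  where
  𝒮A = ℬ𝒜⊆𝒮 A ℬ𝒜A
  open 𝒮-Properties {A} 𝒮A

𝒜₁₂⊆ℱ₂₅ : 𝒜₁₂ ⊆ᶜ ℱ₂₅
𝒜₁₂⊆ℱ₂₅ A (𝒮A , a₁₂) = 𝒮A , F₂₅-law-from id (A₁₂→~∧-absorptive a₁₂)
  where open 𝒮-Properties {A} 𝒮A

𝒜₂₃⊆ℱ₂₅ : 𝒜₂₃ ⊆ᶜ ℱ₂₅
𝒜₂₃⊆ℱ₂₅ A (𝒮A , a₂₃) = 𝒮A , F₂₅-law-from (λ u → ~ u ∧ u) (A₂₃→∨-~∧ a₂₃)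
  where open 𝒮-Properties {A} 𝒮A

ℱ₂₅⊆𝒮 : ℱ₂₅ ⊆ᶜ 𝒮
ℱ₂₅⊆𝒮 A = proj₁

𝒜₂₃∩𝒜₁₂⊆𝒮ℒ : (𝒜₂₃ ∩ᶜ 𝒜₁₂) ⊆ᶜ 𝒮ℒ
𝒜₂₃∩𝒜₁₂⊆𝒮ℒ A ((𝒮A , a₂₃) , (_ , a₁₂)) = proj₁ 𝒮A , ′-identity , ⇒-comm
  where
  open Zroupoid A
  open 𝒮-Properties {A} 𝒮A

  ′-identity : ∀ x → x ′ ≡ x
  ′-identity = A₁₂→A₂₃→′-identity a₁₂ a₂₃

  ⇒-comm : ∀ x y → x ⇒ y ≡ y ⇒ x
  ⇒-comm x y = begin
    x ⇒ y   ≡⟨ cong (_⇒ y) (sym (′-identity x)) ⟩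
    x ′ ⇒ y ≡⟨ ∨-comm x y ⟩
    y ′ ⇒ x ≡⟨ cong (_⇒ x) (′-identity y) ⟩
    y ⇒ x   ∎
    where open ≡-Reasoning

Table : ℕ → Set
Table n = Vec (Vec (Fin n) n) n

module FiniteZroupoid {n : ℕ} (table : Table (suc n)) where

  zroupoid : Zroupoid
  zroupoid = record { Carrier = Fin (suc n) ; _⇒_ = λ x y → lookup (lookup table x) y ; 𝟎 = zero }

  open Zroupoid zroupoid

  IZ? : Dec (IZ zroupoid)
  IZ? = (all? λ x → all? λ y → all? λ z → (x ⇒ y) ⇒ z ≟ ((z ′ ⇒ x) ⇒ (y ⇒ z) ′) ′)
        ×-dec (𝟎 ′ ′ ≟ 𝟎)

  𝒮? : Dec (𝒮 zroupoid)
  𝒮? = IZ? ×-dec (all? λ x → x ′ ′ ≟ x) ×-dec (all? λ x → all? λ y → (x ⇒ y ′) ′ ≟ (y ⇒ x ′) ′)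

  𝒮ℒ? : Dec (𝒮ℒ zroupoid)
  𝒮ℒ? = IZ? ×-dec (all? λ x → x ′ ≟ x) ×-dec (all? λ x → all? λ y → x ⇒ y ≟ y ⇒ x)

  ℬ𝒜? : Dec (ℬ𝒜 zroupoid)
  ℬ𝒜? = IZ? ×-dec (all? λ x → all? λ y → (x ⇒ y) ⇒ x ≟ x) ×-dec (all? λ x → x ⇒ x ≟ 𝟎 ′)

  𝒜₁₂? : Dec (𝒜₁₂ zroupoid)
  𝒜₁₂? = 𝒮? ×-dec (all? λ x → all? λ y → all? λ z → x ⇒ (x ⇒ (y ⇒ z)) ≟ x ⇒ ((x ⇒ y) ⇒ z))

  𝒜₂₃? : Dec (𝒜₂₃ zroupoid)
  𝒜₂₃? = 𝒮? ×-dec (all? λ x → all? λ y → all? λ z → x ⇒ ((x ⇒ y) ⇒ z) ≟ (x ⇒ x) ⇒ (y ⇒ z))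

  ℱ₂₅? : Dec (ℱ₂₅ zroupoid)
  ℱ₂₅? = 𝒮? ×-dec (all? λ x → all? λ y → all? λ z → x ⇒ ((y ⇒ z) ⇒ z) ≟ ((x ⇒ y) ⇒ z) ⇒ z)

-- Each model below is x ⇒ y = x′ ∨ y for a join semilattice with an involution ′.

-- The chain 0 < 1 with ′ the identity.
module Semilattice₂ = FiniteZroupoid
  ( (# 0 ∷ # 1 ∷ [])
  ∷ (# 1 ∷ # 1 ∷ [])
  ∷ [])

-- The chain 0 < 1 with 0′ = 1: the two-element Boolean algebra.
module Boolean₂ = FiniteZroupoid
  ( (# 1 ∷ # 1 ∷ [])
  ∷ (# 0 ∷ # 1 ∷ [])
  ∷ [])

-- The chain 0 < 2 < 1 with 0′ = 1 and 2′ = 2: the three-element Kleene algebra.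
module Kleene₃ = FiniteZroupoid
  ( (# 1 ∷ # 1 ∷ # 1 ∷ [])
  ∷ (# 0 ∷ # 1 ∷ # 2 ∷ [])
  ∷ (# 2 ∷ # 1 ∷ # 2 ∷ [])
  ∷ [])

-- The diamond 0 < 2, 3 < 1 with ′ exchanging the atoms 2 and 3.
module Diamond₄ = FiniteZroupoid
  ( (# 0 ∷ # 1 ∷ # 2 ∷ # 3 ∷ [])
  ∷ (# 1 ∷ # 1 ∷ # 1 ∷ # 1 ∷ [])
  ∷ (# 3 ∷ # 1 ∷ # 1 ∷ # 3 ∷ [])
  ∷ (# 2 ∷ # 1 ∷ # 2 ∷ # 1 ∷ [])
  ∷ [])

private
  variable
    U V W : Class

⊊-⊆-trans : U ⊊ V → V ⊆ᶜ W → U ⊊ W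
⊊-⊆-trans (U⊆V , V⊈U) V⊆W = (λ A → V⊆W A ∘ U⊆V A) , (λ W⊆U → V⊈U (λ A → W⊆U A ∘ V⊆W A))

⊊⇒≉ : V ⊊ W → ¬ (V ≐ W)
⊊⇒≉ (_ , W⊈V) (_ , W⊆V) = W⊈V W⊆V

⊈⇒≉ : ¬ (V ⊆ᶜ W) → ¬ (V ≐ W)
⊈⇒≉ V⊈W (V⊆W , _) = V⊈W V⊆W

⊈-witness : (A : Zroupoid) → V A → ¬ W A → ¬ (V ⊆ᶜ W)
⊈-witness A VA ¬WA V⊆W = ¬WA (V⊆W A VA)

⊊-witness : V ⊆ᶜ W → (A : Zroupoid) → W A → ¬ V A → V ⊊ W
⊊-witness V⊆W A WA ¬VA = V⊆W , ⊈-witness A WA ¬VA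

Nontrivial-mono : V ⊆ᶜ W → Nontrivial V → Nontrivial W
Nontrivial-mono V⊆W (A , VA , distinct) = A , V⊆W A VA , distinct

𝒮ℒ-nontrivial : Nontrivial 𝒮ℒ
𝒮ℒ-nontrivial = Semilattice₂.zroupoid , toWitness {a? = Semilattice₂.𝒮ℒ?} _ , zero , suc zero , λ ()

𝒮ℒ⊊𝒜₂₃ : 𝒮ℒ ⊊ 𝒜₂₃
𝒮ℒ⊊𝒜₂₃ = ⊊-witness 𝒮ℒ⊆𝒜₂₃ Diamond₄.zroupoid
  (toWitness {a? = Diamond₄.𝒜₂₃?} _) (toWitnessFalse {a? = Diamond₄.𝒮ℒ?} _)

𝒜₂₃⊊ℱ₂₅ : 𝒜₂₃ ⊊ ℱ₂₅
𝒜₂₃⊊ℱ₂₅ = ⊊-witness 𝒜₂₃⊆ℱ₂₅ Boolean₂.zroupoid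
  (toWitness {a? = Boolean₂.ℱ₂₅?} _) (toWitnessFalse {a? = Boolean₂.𝒜₂₃?} _)

𝒮ℒ⊊𝒜₁₂ : 𝒮ℒ ⊊ 𝒜₁₂
𝒮ℒ⊊𝒜₁₂ = ⊊-witness 𝒮ℒ⊆𝒜₁₂ Boolean₂.zroupoid
  (toWitness {a? = Boolean₂.𝒜₁₂?} _) (toWitnessFalse {a? = Boolean₂.𝒮ℒ?} _)

ℬ𝒜⊊𝒜₁₂ : ℬ𝒜 ⊊ 𝒜₁₂
ℬ𝒜⊊𝒜₁₂ = ⊊-witness ℬ𝒜⊆𝒜₁₂ Semilattice₂.zroupoid
  (toWitness {a? = Semilattice₂.𝒜₁₂?} _) (toWitnessFalse {a? = Semilattice₂.ℬ𝒜?} _)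

𝒜₁₂⊊ℱ₂₅ : 𝒜₁₂ ⊊ ℱ₂₅
𝒜₁₂⊊ℱ₂₅ = ⊊-witness 𝒜₁₂⊆ℱ₂₅ Diamond₄.zroupoid
  (toWitness {a? = Diamond₄.ℱ₂₅?} _) (toWitnessFalse {a? = Diamond₄.𝒜₁₂?} _)

ℱ₂₅⊊𝒮 : ℱ₂₅ ⊊ 𝒮
ℱ₂₅⊊𝒮 = ⊊-witness ℱ₂₅⊆𝒮 Kleene₃.zroupoid
  (toWitness {a? = Kleene₃.𝒮?} _) (toWitnessFalse {a? = Kleene₃.ℱ₂₅?} _)

𝒜₁₂⊈𝒜₂₃ : ¬ (𝒜₁₂ ⊆ᶜ 𝒜₂₃)
𝒜₁₂⊈𝒜₂₃ = ⊈-witness Boolean₂.zroupoid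
  (toWitness {a? = Boolean₂.𝒜₁₂?} _) (toWitnessFalse {a? = Boolean₂.𝒜₂₃?} _)

theorem4p2 :
    (Nontrivial 𝒮ℒ × Nontrivial 𝒜₁₂ × Nontrivial 𝒜₂₃ × Nontrivial ℱ₂₅ × Nontrivial 𝒮)
    × (¬ (𝒮ℒ ≐ 𝒜₁₂) × ¬ (𝒮ℒ ≐ 𝒜₂₃) × ¬ (𝒮ℒ ≐ ℱ₂₅) × ¬ (𝒮ℒ ≐ 𝒮)
       × ¬ (𝒜₁₂ ≐ 𝒜₂₃) × ¬ (𝒜₁₂ ≐ ℱ₂₅) × ¬ (𝒜₁₂ ≐ 𝒮)
       × ¬ (𝒜₂₃ ≐ ℱ₂₅) × ¬ (𝒜₂₃ ≐ 𝒮)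
       × ¬ (ℱ₂₅ ≐ 𝒮))
    × (𝒮ℒ ⊊ 𝒜₂₃ × 𝒜₂₃ ⊊ ℱ₂₅)
    × (𝒮ℒ ⊊ 𝒜₁₂)
    × (ℬ𝒜 ⊊ 𝒜₁₂ × 𝒜₁₂ ⊊ ℱ₂₅)
    × (ℱ₂₅ ⊊ 𝒮)
    × (𝒮ℒ ≐ (𝒜₂₃ ∩ᶜ 𝒜₁₂))
theorem4p2 =
    ( 𝒮ℒ-nontrivial
    , Nontrivial-mono 𝒮ℒ⊆𝒜₁₂ 𝒮ℒ-nontrivial
    , Nontrivial-mono 𝒮ℒ⊆𝒜₂₃ 𝒮ℒ-nontrivial
    , Nontrivial-mono (proj₁ 𝒮ℒ⊊ℱ₂₅) 𝒮ℒ-nontrivial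
    , Nontrivial-mono 𝒮ℒ⊆𝒮 𝒮ℒ-nontrivial )
  , ( ⊊⇒≉ 𝒮ℒ⊊𝒜₁₂ , ⊊⇒≉ 𝒮ℒ⊊𝒜₂₃ , ⊊⇒≉ 𝒮ℒ⊊ℱ₂₅ , ⊊⇒≉ (⊊-⊆-trans 𝒮ℒ⊊ℱ₂₅ ℱ₂₅⊆𝒮)
    , ⊈⇒≉ 𝒜₁₂⊈𝒜₂₃ , ⊊⇒≉ 𝒜₁₂⊊ℱ₂₅ , ⊊⇒≉ (⊊-⊆-trans 𝒜₁₂⊊ℱ₂₅ ℱ₂₅⊆𝒮)
    , ⊊⇒≉ 𝒜₂₃⊊ℱ₂₅ , ⊊⇒≉ (⊊-⊆-trans 𝒜₂₃⊊ℱ₂₅ ℱ₂₅⊆𝒮)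
    , ⊊⇒≉ ℱ₂₅⊊𝒮 )
  , (𝒮ℒ⊊𝒜₂₃ , 𝒜₂₃⊊ℱ₂₅)
  , 𝒮ℒ⊊𝒜₁₂
  , (ℬ𝒜⊊𝒜₁₂ , 𝒜₁₂⊊ℱ₂₅)
  , ℱ₂₅⊊𝒮
  , ((λ A 𝒮ℒA → 𝒮ℒ⊆𝒜₂₃ A 𝒮ℒA , 𝒮ℒ⊆𝒜₁₂ A 𝒮ℒA) , 𝒜₂₃∩𝒜₁₂⊆𝒮ℒ)
  where
  𝒮ℒ⊊ℱ₂₅ : 𝒮ℒ ⊊ ℱ₂₅
  𝒮ℒ⊊ℱ₂₅ = ⊊-⊆-trans 𝒮ℒ⊊𝒜₂₃ 𝒜₂₃⊆ℱ₂₅
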